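{- For each $i \geq 2$ and $0 \leq j \leq i-1$, let $A_{i,j}$ and $B_{i,j}$ denote the set of the starting positions of the occurrences of $T_{i-j}$ and $\overline{T_{i-j}}$ in $T_i$, respectively. Then $A_{i,0} = A_{i,1} = \{1\}$. For each $j \geq 2$, define \begin{align*} B_{i,j-1}' &:= B_{i,j-1} \oplus \tau_{i-j}, \qquad A_{i,j-2}' := A_{i,j-2} \oplus \left(\tau_{i-j} + \tau_{i-(j+1)}\right), \\ I_{i,j-3} &:= \begin{cases} \emptyset, & j = 2, \\ A_{i, j-3}' \cup B_{i, j-3}', & j \geq 3, \text{ where} \end{cases} \\ A_{i, j-3}' &:= A_{i,j-3} \oplus (\tau_{i-(j-1)} + \tau_{i-j}), \qquad B_{i, j-3}' := B_{i,j-3} \oplus \tau_{i-(j-2)}. \end{align*} Then $A_{i,j} = A_{i,j-1} \cup B_{i,j-1}' \cup A_{i,j-2}'$ with \[ A_{i,j-1} \cap B_{i,j-1}' = I_{i,j-3}, \quad A_{i,j-1} \cap A_{i,j-2}' = \emptyset, \quad \text{and} \quad B_{i,j-1}' \cap A_{i,j-2}' = \emptyset. \]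
   Context: Strings are over $\{\texttt{a},\texttt{b}\}$. For a binary string $S$, $\overline{S}$ is obtained by swapping \texttt{a} and \texttt{b}. The Thue-Morse word is $T_1 := \texttt{a}$, $T_i := T_{i-1}\overline{T_{i-1}}$ for $i\ge 2$, and $\tau_i := |T_i| = 2^{i-1}$. For a set of integers $A$ and an integer $i$, $A \oplus i := \{a+i : a \in A\}$. -}

module Defs where

open import Data.Bool using (Bool; true; false; not)
open import Data.List using (List; []; _∷_; _++_; map; length)
open import Data.Nat using (ℕ; zero; suc; _+_; _∸_; _^_)
open import Data.Product using (Σ; ∃; _×_; _,_)
open import Data.Sum using (_⊎_)
open import Data.Empty using (⊥)
open import Relation.Binary.PropositionalEquality using (_≡_)

-- Letters: 'a' = false, 'b' = true.
Word : Set
Word = List Bool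

compl : Word → Word
compl = map not

-- tm n = T_{n+1}
tm : ℕ → Word
tm zero    = false ∷ []
tm (suc n) = tm n ++ compl (tm n)

-- Thue–Morse word T_i (meaningful for i ≥ 1; T_0 is junk = T_1)
T : ℕ → Word
T i = tm (i ∸ 1)

-- τ_i = |T_i| = 2^(i-1)  (meaningful for i ≥ 1)
τ : ℕ → ℕ
τ i = 2 ^ (i ∸ 1)

NSet : Set₁
NSet = ℕ → Set

-- u occurs in w starting at the 1-indexed position p
OccursAt : Word → Word → ℕ → Set
OccursAt u w p = Σ Word λ x → Σ Word λ y → (w ≡ x ++ u ++ y) × (p ≡ suc (length x))

A : ℕ → ℕ → NSet
A i j = OccursAt (T (i ∸ j)) (T i)

B : ℕ → ℕ → NSet
B i j = OccursAt (compl (T (i ∸ j))) (T i)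

_⊕_ : NSet → ℕ → NSet
(S ⊕ k) p = Σ ℕ λ a → S a × (p ≡ a + k)

_∪_ : NSet → NSet → NSet
(S ∪ R) p = S p ⊎ R p

_∩_ : NSet → NSet → NSet
(S ∩ R) p = S p × R p

∅ : NSet
∅ _ = ⊥

｛_｝ : ℕ → NSet
｛ n ｝ p = p ≡ n

infix 4 _≐_
_≐_ : NSet → NSet → Set
S ≐ R = ∀ p → (S p → R p) × (R p → S p)

infixl 6 _⊕_
infixl 5 _∪_
infixl 5 _∩_

-- B'_{i,j-1} := B_{i,j-1} ⊕ τ_{i-j}
B′ : ℕ → ℕ → NSet
B′ i j = B i (j ∸ 1) ⊕ τ (i ∸ j)

-- A'_{i,j-2} := A_{i,j-2} ⊕ (τ_{i-j} + τ_{i-(j+1)})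
A′ : ℕ → ℕ → NSet
A′ i j = A i (j ∸ 2) ⊕ (τ (i ∸ j) + τ (i ∸ (j + 1)))

-- I_{i,j-3}: ∅ if j = 2, else A'_{i,j-3} ∪ B'_{i,j-3} where
-- A'_{i,j-3} := A_{i,j-3} ⊕ (τ_{i-(j-1)} + τ_{i-j}),  B'_{i,j-3} := B_{i,j-3} ⊕ τ_{i-(j-2)}
-- (values for j < 2 are junk, never used)
I : ℕ → ℕ → NSet
I i zero = ∅
I i (suc zero) = ∅
I i (suc (suc zero)) = ∅
I i (suc (suc (suc k))) =
  (A i k ⊕ (τ (i ∸ (k + 2)) + τ (i ∸ (k + 3)))) ∪ (B i k ⊕ τ (i ∸ (k + 1)))

-- Let t be the Thue–Morse sequence, t(2n) = t(n) and t(2n+1) = ¬t(n), so that T_i is its prefix of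
-- length 2^(i-1). A copy of T_{k+m} (m ≥ 2) or of its complement can start in t only at a multiple
-- of 2^k, and dividing the position by 2^k gives a copy of T_m or of its complement. Hence, for
-- i = j + 2 + a, every set in the statement is the image under c ↦ 1 + c·2^a of a set of occurrences
-- of ab, abba, baab, abbabaab, T_5 or its complement in the prefix of t of length 2^(j+1). For these
-- the identities are read off from blocks: on [2^k·q, 2^k·(q+2)) the sequence t is T_{k+1} or its
-- complement according to t(q), followed by the same according to t(q+1).
module Submission where

open import Defs
open import Data.Bool using (Bool; true; false; not; _xor_)
open import Data.Bool.Properties
  using (not-involutive; not-injective; not-¬; not-distribʳ-xor; xor-assoc; xor-comm; xor-identityʳ)
open import Data.Empty using (⊥; ⊥-elim)
open import Data.Fin.Patterns using (0F; 1F; 2F; 3F; 4F; 5F; 6F; 7F)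
open import Data.List using ([]; _∷_; _++_; length)
open import Data.List.Properties using (length-++; length-map; ++-identityʳ)
open import Data.Nat using (ℕ; zero; suc; _+_; _*_; _∸_; _^_; _≤_; _<_; z≤n; s≤s; z<s; ⌊_/2⌋; _<?_)
open import Data.Nat.Divisibility using (_∣_; divides; n∣m*n; ∣-trans)
open import Data.Nat.DivMod using (_divMod_; result)
open import Data.Nat.Properties
open import Algebra.Properties.CommutativeSemigroup +-commutativeSemigroup using (x∙yz≈xz∙y; x∙yz≈y∙xz)
open import Data.Nat.Tactic.RingSolver using (solve)
open import Data.Product using (Σ; _×_; _,_; proj₁; proj₂)
import Data.Product as Product
open import Data.Sum using (inj₁; inj₂)
import Data.Sum as Sum
open import Function using (_∘′_)
open import Level using (0ℓ) renaming (suc to lsuc)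
open import Relation.Binary.Bundles using (Setoid)
open import Relation.Binary.PropositionalEquality
import Relation.Binary.Reasoning.Setoid as SetoidReasoning
open import Relation.Nullary using (yes; no)
open import Relation.Nullary.Decidable using (True; toWitness)

isOdd : ℕ → Bool
isOdd zero    = false
isOdd (suc n) = not (isOdd n)

tmBitWithFuel : ℕ → ℕ → Bool
tmBitWithFuel zero    _ = false
tmBitWithFuel (suc f) n = isOdd n xor tmBitWithFuel f ⌊ n /2⌋

tmBit : ℕ → Bool
tmBit n = tmBitWithFuel n n

tmBitWithFuel-0 : ∀ f → tmBitWithFuel f 0 ≡ false
tmBitWithFuel-0 zero    = refl
tmBitWithFuel-0 (suc f) = tmBitWithFuel-0 f

tmBitWithFuel-irrelevant : ∀ f g n → n ≤ f → n ≤ g → tmBitWithFuel f n ≡ tmBitWithFuel g n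
tmBitWithFuel-irrelevant f g zero _ _ = trans (tmBitWithFuel-0 f) (sym (tmBitWithFuel-0 g))
tmBitWithFuel-irrelevant (suc f) (suc g) (suc n) (s≤s n≤f) (s≤s n≤g) =
  cong (isOdd (suc n) xor_) (tmBitWithFuel-irrelevant f g ⌊ suc n /2⌋ (≤-trans half≤n n≤f) (≤-trans half≤n n≤g))
  where half≤n = ≤-pred (⌊n/2⌋<n n)

tmBit-step : ∀ n → tmBit n ≡ isOdd n xor tmBit ⌊ n /2⌋
tmBit-step zero    = refl
tmBit-step (suc n) = cong (isOdd (suc n) xor_)
  (tmBitWithFuel-irrelevant n ⌊ suc n /2⌋ ⌊ suc n /2⌋ (≤-pred (⌊n/2⌋<n n)) ≤-refl)

isOdd-double : ∀ q → isOdd (q * 2) ≡ false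
isOdd-double zero    = refl
isOdd-double (suc q) = trans (not-involutive _) (isOdd-double q)

⌊double/2⌋ : ∀ q → ⌊ q * 2 /2⌋ ≡ q
⌊double/2⌋ zero    = refl
⌊double/2⌋ (suc q) = cong suc (⌊double/2⌋ q)

⌊double+1/2⌋ : ∀ q → ⌊ suc (q * 2) /2⌋ ≡ q
⌊double+1/2⌋ zero    = refl
⌊double+1/2⌋ (suc q) = cong suc (⌊double+1/2⌋ q)

tmBit-double : ∀ q → tmBit (q * 2) ≡ tmBit q
tmBit-double q = trans (tmBit-step (q * 2)) (cong₂ _xor_ (isOdd-double q) (cong tmBit (⌊double/2⌋ q)))

tmBit-double+1 : ∀ q → tmBit (suc (q * 2)) ≡ not (tmBit q)
tmBit-double+1 q = trans (tmBit-step (suc (q * 2)))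
  (cong₂ _xor_ (cong not (isOdd-double q)) (cong tmBit (⌊double+1/2⌋ q)))

-- t has a copy of T_{K+1}, or of its complement when b = true, at the 0-indexed position q
record CopyAt (b : Bool) (K q : ℕ) : Set where
  constructor copyAt
  field letter : ∀ r → r < 2 ^ K → tmBit (r + q) ≡ b xor tmBit r
open CopyAt

CopyAt-single : ∀ {b} q → tmBit q ≡ b → CopyAt b 0 q
CopyAt-single {b} q tq≡b = copyAt λ where
  zero    _        → trans tq≡b (sym (xor-identityʳ b))
  (suc _) (s≤s ())

CopyAt-pair : ∀ {b} q → tmBit q ≡ b → tmBit (suc q) ≡ not b → CopyAt b 1 q
CopyAt-pair {b} q tq≡b tq+1≡¬b = copyAt λ where
  0             _               → trans tq≡b (sym (xor-identityʳ b))
  1             _               → trans tq+1≡¬b (sym (xor-comm b true))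
  (suc (suc _)) (s≤s (s≤s ()))

half-< : ∀ {s} K → s * 2 < 2 ^ suc K → s < 2 ^ K
half-< {s} K s*2< = *-cancelʳ-< 2 s (2 ^ K) (subst (s * 2 <_) (*-comm 2 (2 ^ K)) s*2<)

CopyAt-double : ∀ {b K q} → CopyAt b K q → CopyAt b (suc K) (q * 2)
CopyAt-double {b} {K} {q} copy = copyAt doubled
  where
  open ≡-Reasoning
  doubled : ∀ r → r < 2 ^ suc K → tmBit (r + q * 2) ≡ b xor tmBit r
  doubled r r< with r divMod 2
  ... | result s 0F refl = begin
    tmBit (s * 2 + q * 2)        ≡⟨ cong tmBit (*-distribʳ-+ 2 s q) ⟨
    tmBit ((s + q) * 2)          ≡⟨ tmBit-double (s + q) ⟩
    tmBit (s + q)                ≡⟨ letter copy s (half-< K r<) ⟩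
    b xor tmBit s                ≡⟨ cong (b xor_) (tmBit-double s) ⟨
    b xor tmBit (s * 2)          ∎
  ... | result s 1F refl = begin
    tmBit (suc (s * 2 + q * 2))  ≡⟨ cong (tmBit ∘′ suc) (*-distribʳ-+ 2 s q) ⟨
    tmBit (suc ((s + q) * 2))    ≡⟨ tmBit-double+1 (s + q) ⟩
    not (tmBit (s + q))          ≡⟨ cong not (letter copy s (half-< K (<-trans (n<1+n _) r<))) ⟩
    not (b xor tmBit s)          ≡⟨ not-distribʳ-xor b (tmBit s) ⟩
    b xor not (tmBit s)          ≡⟨ cong (b xor_) (tmBit-double+1 s) ⟨
    b xor tmBit (suc (s * 2))    ∎

CopyAt-halve : ∀ {b K q} → CopyAt b (suc K) (q * 2) → CopyAt b K q
CopyAt-halve {b} {K} {q} copy = copyAt λ r r< → begin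
  tmBit (r + q)            ≡⟨ tmBit-double (r + q) ⟨
  tmBit ((r + q) * 2)      ≡⟨ cong tmBit (*-distribʳ-+ 2 r q) ⟩
  tmBit (r * 2 + q * 2)    ≡⟨ letter copy (r * 2) (subst (r * 2 <_) (*-comm (2 ^ K) 2) (*-monoˡ-< 2 r<)) ⟩
  b xor tmBit (r * 2)      ≡⟨ cong (b xor_) (tmBit-double r) ⟩
  b xor tmBit r            ∎
  where open ≡-Reasoning

-- Letters 1 and 2 of T_{K+1} agree, but t(2q+2) = t(q+1) ≠ t(2q+3).
CopyAt-odd-impossible : ∀ {b K q} → 2 ≤ K → CopyAt b K (suc (q * 2)) → ⊥
CopyAt-odd-impossible {b} {K} {q} 2≤K copy =
  not-¬ letter₁ (trans (sym (not-involutive _)) (cong not letter₂))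
  where
  4≤2^K : 4 ≤ 2 ^ K
  4≤2^K = ^-monoʳ-≤ 2 2≤K
  letter₁ : tmBit (suc q) ≡ b xor true
  letter₁ = trans (sym (tmBit-double (suc q))) (letter copy 1 (<-≤-trans (≤ᵇ⇒≤ 2 4 _) 4≤2^K))
  letter₂ : not (tmBit (suc q)) ≡ b xor true
  letter₂ = trans (sym (tmBit-double+1 (suc q))) (letter copy 2 (<-≤-trans (≤ᵇ⇒≤ 3 4 _) 4≤2^K))

*2^-suc : ∀ c a → c * 2 ^ a * 2 ≡ c * 2 ^ suc a
*2^-suc c a = trans (*-assoc c (2 ^ a) 2) (cong (c *_) (*-comm (2 ^ a) 2))

CopyAt-scale : ∀ {b K c} a → CopyAt b K c → CopyAt b (a + K) (c * 2 ^ a)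
CopyAt-scale {b} {K} {c} zero    copy = subst (CopyAt b K) (sym (*-identityʳ c)) copy
CopyAt-scale {b} {K} {c} (suc a) copy =
  subst (CopyAt b (suc (a + K))) (*2^-suc c a) (CopyAt-double (CopyAt-scale a copy))

CopyAt-align : ∀ {b K q} a → CopyAt b (a + suc K) q → Σ ℕ λ c → q ≡ c * 2 ^ a × CopyAt b (suc K) c
CopyAt-align {q = q} zero copy = q , sym (*-identityʳ q) , copy
CopyAt-align {K = K} {q} (suc a) copy with q divMod 2
... | result e 0F refl with CopyAt-align a (CopyAt-halve {q = e} copy)
...   | c , refl , copy′ = c , *2^-suc c a , copy′
CopyAt-align {K = K} (suc a) copy | result e 1F refl =
  ⊥-elim (CopyAt-odd-impossible {q = e} (s≤s (≤-trans (s≤s z≤n) (m≤n+m (suc K) a))) copy)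

tmBit-block : ∀ k q {u} → u < 2 ^ k → tmBit (u + q * 2 ^ k) ≡ tmBit u xor tmBit q
tmBit-block k q {u} u< =
  trans (letter (CopyAt-scale k (CopyAt-single q refl)) u (subst (λ n → u < 2 ^ n) (sym (+-identityʳ k)) u<))
        (xor-comm (tmBit q) (tmBit u))

CopyAt-compose : ∀ {b b′ K K′ c d} → CopyAt b K c → CopyAt b′ K′ d → 2 ^ K′ + d ≤ 2 ^ K →
                 CopyAt (b xor b′) K′ (c + d)
CopyAt-compose {b} {b′} {c = c} {d} outer inner fits = copyAt λ r r< → begin
  tmBit (r + (c + d))        ≡⟨ cong tmBit (x∙yz≈xz∙y r c d) ⟩
  tmBit (r + d + c)          ≡⟨ letter outer (r + d) (<-≤-trans (+-monoˡ-< d r<) fits) ⟩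
  b xor tmBit (r + d)        ≡⟨ cong (b xor_) (letter inner r r<) ⟩
  b xor (b′ xor tmBit r)     ≡⟨ xor-assoc b b′ (tmBit r) ⟨
  (b xor b′) xor tmBit r     ∎
  where open ≡-Reasoning

CopyWithin : ℕ → Bool → ℕ → NSet
CopyWithin M b K q = 2 ^ K + q ≤ M × CopyAt b K q

CopyWithin-compose : ∀ {M b b′ K K′ c d} → CopyWithin M b K c → CopyAt b′ K′ d → 2 ^ K′ + d ≤ 2 ^ K →
                     CopyWithin M (b xor b′) K′ (c + d)
CopyWithin-compose {M} {K = K} {K′} {c} {d} (inside , outer) inner fits =
  ≤-trans (≤-reflexive (x∙yz≈xz∙y (2 ^ K′) c d)) (≤-trans (+-monoˡ-≤ c fits) inside) ,
  CopyAt-compose outer inner fits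

-- out-of-range positions read as false; every use below is in range
at : Word → ℕ → Bool
at []      _       = false
at (x ∷ w) zero    = x
at (x ∷ w) (suc r) = at w r

at-++ˡ : ∀ (x : Word) y {r} → r < length x → at (x ++ y) r ≡ at x r
at-++ˡ (_ ∷ _) _ {zero}  _         = refl
at-++ˡ (_ ∷ x) y {suc r} (s≤s r<) = at-++ˡ x y r<

at-++ʳ : ∀ (x : Word) y r → at (x ++ y) (length x + r) ≡ at y r
at-++ʳ []      _ _ = refl
at-++ʳ (_ ∷ x) y r = at-++ʳ x y r

at-compl : ∀ (w : Word) {r} → r < length w → at (compl w) r ≡ not (at w r)
at-compl (_ ∷ _) {zero}  _        = refl
at-compl (_ ∷ w) {suc r} (s≤s r<) = at-compl w r<

length-tm : ∀ n → length (tm n) ≡ 2 ^ n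
length-tm zero    = refl
length-tm (suc n) = begin
  length (tm n ++ compl (tm n))           ≡⟨ length-++ (tm n) ⟩
  length (tm n) + length (compl (tm n))   ≡⟨ cong (length (tm n) +_) (length-map not (tm n)) ⟩
  length (tm n) + length (tm n)           ≡⟨ cong₂ _+_ (length-tm n) (trans (length-tm n) (sym (+-identityʳ _))) ⟩
  2 ^ suc n                               ∎
  where open ≡-Reasoning

tmBit-second-half : ∀ n {r} → r < 2 ^ n → tmBit (2 ^ n + r) ≡ not (tmBit r)
tmBit-second-half n {r} r< = begin
  tmBit (2 ^ n + r)           ≡⟨ cong tmBit (trans (+-comm (2 ^ n) r) (cong (r +_) (sym (*-identityˡ (2 ^ n))))) ⟩
  tmBit (r + 1 * 2 ^ n)       ≡⟨ tmBit-block n 1 r< ⟩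
  tmBit r xor true            ≡⟨ xor-comm (tmBit r) true ⟩
  not (tmBit r)               ∎
  where open ≡-Reasoning

at-tm : ∀ n {r} → r < 2 ^ n → at (tm n) r ≡ tmBit r
at-tm zero    {zero}  _        = refl
at-tm zero    {suc r} (s≤s ())
at-tm (suc n) {r}     r< with r <? 2 ^ n
... | yes r<2ⁿ = trans (at-++ˡ (tm n) _ (subst (r <_) (sym (length-tm n)) r<2ⁿ)) (at-tm n r<2ⁿ)
... | no  r≮2ⁿ with m≤n⇒∃[o]m+o≡n (≮⇒≥ r≮2ⁿ)
...   | r′ , refl = begin
  at (tm n ++ compl (tm n)) (2 ^ n + r′)  ≡⟨ subst (λ ℓ → at (tm n ++ compl (tm n)) (ℓ + r′) ≡ at (compl (tm n)) r′)
                                                   (length-tm n) (at-++ʳ (tm n) _ r′) ⟩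
  at (compl (tm n)) r′                    ≡⟨ at-compl (tm n) (subst (r′ <_) (sym (length-tm n)) r′<) ⟩
  not (at (tm n) r′)                      ≡⟨ cong not (at-tm n r′<) ⟩
  not (tmBit r′)                          ≡⟨ tmBit-second-half n r′< ⟨
  tmBit (2 ^ n + r′)                      ∎
  where
  open ≡-Reasoning
  r′< : r′ < 2 ^ n
  r′< = +-cancelˡ-< (2 ^ n) r′ (2 ^ n) (subst (2 ^ n + r′ <_) (cong (2 ^ n +_) (+-identityʳ _)) r<)

tmFlip : Bool → ℕ → Word
tmFlip false n = tm n
tmFlip true  n = compl (tm n)

length-tmFlip : ∀ b n → length (tmFlip b n) ≡ 2 ^ n
length-tmFlip false n = length-tm n
length-tmFlip true  n = trans (length-map not (tm n)) (length-tm n)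

at-tmFlip : ∀ b n {r} → r < 2 ^ n → at (tmFlip b n) r ≡ b xor tmBit r
at-tmFlip false n r< = at-tm n r<
at-tmFlip true  n r< = trans (at-compl (tm n) (subst (_ <_) (sym (length-tm n)) r<)) (cong not (at-tm n r<))

occursAt⇒ : ∀ {u w p} → OccursAt u w p →
            Σ ℕ λ q → p ≡ suc q × q + length u ≤ length w × (∀ r → r < length u → at w (q + r) ≡ at u r)
occursAt⇒ {u} (x , y , refl , refl) =
  length x , refl , fits , λ r r< → trans (at-++ʳ x (u ++ y) r) (at-++ˡ u y r<)
  where
  fits : length x + length u ≤ length (x ++ u ++ y)
  fits = subst (length x + length u ≤_) (sym (trans (length-++ x) (cong (length x +_) (length-++ u))))
               (+-monoʳ-≤ (length x) (m≤m+n (length u) (length y)))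

prefix⇐ : ∀ (u w : Word) → length u ≤ length w → (∀ r → r < length u → at w r ≡ at u r) → Σ Word λ y → w ≡ u ++ y
prefix⇐ []      w       _         _      = w , refl
prefix⇐ (x ∷ u) (c ∷ w) (s≤s u≤w) agrees with prefix⇐ u w u≤w (λ r r< → agrees (suc r) (s≤s r<))
... | y , refl = y , cong (_∷ u ++ y) (agrees 0 z<s)

occursAt⇐ : ∀ {u} q (w : Word) → q + length u ≤ length w → (∀ r → r < length u → at w (q + r) ≡ at u r) →
            OccursAt u w (suc q)
occursAt⇐ {u} zero    w       fits agrees with prefix⇐ u w fits agrees
... | y , w≡u++y = [] , y , w≡u++y , refl
occursAt⇐ (suc q) (c ∷ w) (s≤s fits) agrees with occursAt⇐ q w fits agrees
... | x , y , w≡x++u++y , refl = c ∷ x , y , cong (c ∷_) w≡x++u++y , refl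

occursAt-tm⇒ : ∀ b n m {p} → OccursAt (tmFlip b n) (tm m) p → Σ ℕ λ q → p ≡ suc q × CopyWithin (2 ^ m) b n q
occursAt-tm⇒ b n m occ with occursAt⇒ occ
... | q , p≡1+q , fits , agrees = q , p≡1+q , inside , copyAt λ r r< →
  trans (cong tmBit (+-comm r q))
        (trans (sym (at-tm m (<-≤-trans (+-monoʳ-< q r<) inside′)))
               (trans (agrees r (subst (r <_) (sym (length-tmFlip b n)) r<)) (at-tmFlip b n r<)))
  where
  inside′ : q + 2 ^ n ≤ 2 ^ m
  inside′ = subst₂ (λ ℓ L → q + ℓ ≤ L) (length-tmFlip b n) (length-tm m) fits
  inside : 2 ^ n + q ≤ 2 ^ m
  inside = subst (_≤ 2 ^ m) (+-comm q (2 ^ n)) inside′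

occursAt-tm⇐ : ∀ b n m {q} → CopyWithin (2 ^ m) b n q → OccursAt (tmFlip b n) (tm m) (suc q)
occursAt-tm⇐ b n m {q} (inside , copy) =
  occursAt⇐ q (tm m) (subst₂ (λ ℓ L → q + ℓ ≤ L) (sym (length-tmFlip b n)) (sym (length-tm m)) inside′)
    λ r r< → let r<2ⁿ = subst (r <_) (length-tmFlip b n) r< in
      trans (at-tm m (<-≤-trans (+-monoʳ-< q r<2ⁿ) inside′))
            (trans (cong tmBit (+-comm q r)) (trans (letter copy r r<2ⁿ) (sym (at-tmFlip b n r<2ⁿ))))
  where
  inside′ : q + 2 ^ n ≤ 2 ^ m
  inside′ = subst (_≤ 2 ^ m) (+-comm (2 ^ n) q) inside

scaled : ℕ → NSet → NSet
scaled a Q p = Σ ℕ λ c → Q c × (p ≡ suc (c * 2 ^ a))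

scaled-end : ∀ a K c → 2 ^ (a + K) + c * 2 ^ a ≡ (2 ^ K + c) * 2 ^ a
scaled-end a K c = begin
  2 ^ (a + K) + c * 2 ^ a       ≡⟨ cong (_+ c * 2 ^ a) (trans (^-distribˡ-+-* 2 a K) (*-comm (2 ^ a) (2 ^ K))) ⟩
  2 ^ K * 2 ^ a + c * 2 ^ a     ≡⟨ *-distribʳ-+ (2 ^ a) (2 ^ K) c ⟨
  (2 ^ K + c) * 2 ^ a           ∎
  where open ≡-Reasoning

CopyWithin-scale : ∀ {M b K c} a → CopyWithin M b K c → CopyWithin (M * 2 ^ a) b (a + K) (c * 2 ^ a)
CopyWithin-scale {M} {K = K} {c} a (inside , copy) =
  subst (_≤ M * 2 ^ a) (sym (scaled-end a K c)) (*-monoˡ-≤ (2 ^ a) inside) , CopyAt-scale a copy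

CopyWithin-align : ∀ {M b K q} a → CopyWithin (M * 2 ^ a) b (a + suc K) q →
                   Σ ℕ λ c → q ≡ c * 2 ^ a × CopyWithin M b (suc K) c
CopyWithin-align {M} {K = K} a (inside , copy) with CopyAt-align a copy
... | c , refl , copy′ =
  c , refl , *-cancelʳ-≤ _ M (2 ^ a) {{m^n≢0 2 a}} (subst (_≤ M * 2 ^ a) (scaled-end a (suc K) c) inside) , copy′

occurrences-scaled : ∀ b {x y} a K N → x ≡ a + suc K → y ≡ a + N →
  OccursAt (tmFlip b x) (tm y) ≐ scaled a (CopyWithin (2 ^ N) b (suc K))
occurrences-scaled b a K N refl refl p = to , from
  where
  2^[a+N] : 2 ^ (a + N) ≡ 2 ^ N * 2 ^ a
  2^[a+N] = trans (^-distribˡ-+-* 2 a N) (*-comm (2 ^ a) (2 ^ N))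
  to : OccursAt (tmFlip b (a + suc K)) (tm (a + N)) p → scaled a (CopyWithin (2 ^ N) b (suc K)) p
  to occ with occursAt-tm⇒ b (a + suc K) (a + N) occ
  ... | q , refl , within with CopyWithin-align {2 ^ N} a (subst (λ M → CopyWithin M b (a + suc K) q) 2^[a+N] within)
  ...   | c , refl , within′ = c , within′ , refl
  from : scaled a (CopyWithin (2 ^ N) b (suc K)) p → OccursAt (tmFlip b (a + suc K)) (tm (a + N)) p
  from (c , within , refl) = occursAt-tm⇐ b (a + suc K) (a + N)
    (subst (λ M → CopyWithin M b (a + suc K) (c * 2 ^ a)) (sym 2^[a+N]) (CopyWithin-scale {2 ^ N} a within))

≐-refl : ∀ {S} → S ≐ S
≐-refl _ = (λ x → x) , (λ x → x)

≐-sym : ∀ {S R} → S ≐ R → R ≐ S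
≐-sym S≐R p = proj₂ (S≐R p) , proj₁ (S≐R p)

≐-trans : ∀ {S R U} → S ≐ R → R ≐ U → S ≐ U
≐-trans S≐R R≐U p = (λ x → proj₁ (R≐U p) (proj₁ (S≐R p) x)) , (λ x → proj₂ (S≐R p) (proj₂ (R≐U p) x))

≐-setoid : Setoid (lsuc 0ℓ) 0ℓ
≐-setoid = record
  { Carrier = NSet ; _≈_ = _≐_
  ; isEquivalence = record { refl = ≐-refl ; sym = ≐-sym ; trans = ≐-trans } }

∪-cong : ∀ {S S′ R R′} → S ≐ S′ → R ≐ R′ → S ∪ R ≐ S′ ∪ R′
∪-cong S≐S′ R≐R′ p =
  Sum.map (proj₁ (S≐S′ p)) (proj₁ (R≐R′ p)) , Sum.map (proj₂ (S≐S′ p)) (proj₂ (R≐R′ p))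

∩-cong : ∀ {S S′ R R′} → S ≐ S′ → R ≐ R′ → S ∩ R ≐ S′ ∩ R′
∩-cong S≐S′ R≐R′ p =
  Product.map (proj₁ (S≐S′ p)) (proj₁ (R≐R′ p)) , Product.map (proj₂ (S≐S′ p)) (proj₂ (R≐R′ p))

⊕-cong : ∀ {S S′ k k′} → S ≐ S′ → k ≡ k′ → S ⊕ k ≐ S′ ⊕ k′
⊕-cong S≐S′ refl p =
  (λ (a , s , e) → a , proj₁ (S≐S′ a) s , e) , (λ (a , s , e) → a , proj₂ (S≐S′ a) s , e)

scaled-cong : ∀ a {Q R} → Q ≐ R → scaled a Q ≐ scaled a R
scaled-cong a Q≐R p = (λ (c , q , e) → c , proj₁ (Q≐R c) q , e) , (λ (c , r , e) → c , proj₂ (Q≐R c) r , e)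

scaled-∪ : ∀ a {Q R} → scaled a (Q ∪ R) ≐ scaled a Q ∪ scaled a R
scaled-∪ a p = (λ { (c , inj₁ q , e) → inj₁ (c , q , e) ; (c , inj₂ r , e) → inj₂ (c , r , e) })
             , (λ { (inj₁ (c , q , e)) → c , inj₁ q , e ; (inj₂ (c , r , e)) → c , inj₂ r , e })

scaled-∩ : ∀ a {Q R} → scaled a (Q ∩ R) ≐ scaled a Q ∩ scaled a R
scaled-∩ a {Q} {R} p = (λ (c , (q , r) , e) → (c , q , e) , (c , r , e)) , from
  where
  from : (scaled a Q ∩ scaled a R) p → scaled a (Q ∩ R) p
  from ((c , q , refl) , (c′ , r , e)) with *-cancelʳ-≡ c c′ (2 ^ a) {{m^n≢0 2 a}} (suc-injective e)
  ... | refl = c , (q , r) , refl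

scaled-⊕ : ∀ a {Q} d → scaled a (Q ⊕ d) ≐ scaled a Q ⊕ d * 2 ^ a
scaled-⊕ a d p =
  (λ { (_ , (c , q , refl) , refl) → suc (c * 2 ^ a) , (c , q , refl) , cong suc (*-distribʳ-+ (2 ^ a) c d) }) ,
  (λ { (_ , (c , q , refl) , refl) → c + d , (c , q , refl) , cong suc (sym (*-distribʳ-+ (2 ^ a) c d)) })

scaled-∅ : ∀ a → scaled a ∅ ≐ ∅
scaled-∅ a p = (λ ()) , (λ ())

next-multiple : ∀ {m M x} → m ∣ M → m ∣ x → ∀ d → d + x < M → m + x ≤ M
next-multiple {m} (divides k refl) (divides j refl) d d+x<M =
  *-monoˡ-≤ m (*-cancelʳ-< m j k (≤-<-trans (m≤n+m (j * m) d) d+x<M))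

_!_ : ∀ {b K q} → CopyAt b K q → ∀ r → {True (r <? 2 ^ K)} → tmBit (r + q) ≡ b xor tmBit r
(copy ! r) {r<} = letter copy r (toWitness r<)

blockLetter : ∀ k q u → {True (u <? 2 ^ k)} → tmBit (u + q * 2 ^ k) ≡ tmBit u xor tmBit q
blockLetter k q u {u<} = tmBit-block k q (toWitness u<)

sameBlockLetter : ∀ k q u u′ → {True (u <? 2 ^ k)} → {True (u′ <? 2 ^ k)} → tmBit u ≡ tmBit u′ →
                  tmBit (u + q * 2 ^ k) ≡ tmBit (u′ + q * 2 ^ k)
sameBlockLetter k q u u′ {u<} {u′<} tu≡tu′ =
  trans (blockLetter k q u {u<}) (trans (cong (_xor tmBit q) tu≡tu′) (sym (blockLetter k q u′ {u′<})))

letters-clash : ∀ {x y b : Bool} → x ≡ y → x ≡ b → y ≡ not b → ⊥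
letters-clash x≡y x≡b y≡¬b = not-¬ (trans (sym x≡y) x≡b) y≡¬b

CopyWithin-too-long : ∀ {M b K q} → M < 2 ^ K → CopyWithin M b K q → ⊥
CopyWithin-too-long {K = K} {q} M<2^K (inside , _) = <⇒≱ M<2^K (≤-trans (m≤m+n (2 ^ K) q) inside)

ab-at-0 : CopyAt false 1 0
ab-at-0 = CopyAt-pair 0 refl refl

ba-at-2 : CopyAt true 1 2
ba-at-2 = CopyAt-pair 2 refl refl

ab-at-3 : CopyAt false 1 3
ab-at-3 = CopyAt-pair 3 refl refl

baab-at-4 : CopyAt true 2 4
baab-at-4 = CopyAt-double ba-at-2

abba-at-6 : CopyAt false 2 6
abba-at-6 = CopyAt-double ab-at-3

baab-at-8 : CopyAt true 2 8
baab-at-8 = CopyAt-double (CopyAt-pair 4 refl refl)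

module Prefix (M : ℕ) where

  ab abba baab abbabaab T₅ T₅ᶜ : NSet
  ab       = CopyWithin M false 1
  abba     = CopyWithin M false 2
  baab     = CopyWithin M true 2
  abbabaab = CopyWithin M false 3
  T₅       = CopyWithin M false 4
  T₅ᶜ      = CopyWithin M true 4

  ab-split⇒ : 4 ∣ M → ∀ c → ab c → (abba ∪ baab ⊕ 2 ∪ abbabaab ⊕ 3) c
  ab-split⇒ 4∣M c (inside , copy) with c divMod 4
  ... | result e 0F refl =
    inj₁ (inj₁ (next-multiple 4∣M (n∣m*n e) 1 inside , CopyAt-scale 2 (CopyAt-single e te≡a)))
    where
    te≡a : tmBit e ≡ false
    te≡a = trans (sym (blockLetter 2 e 0)) (copy ! 0)
  ... | result e 1F refl = ⊥-elim (letters-clash (sameBlockLetter 2 e 1 2 refl) (copy ! 0) (copy ! 1))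
  ... | result e 2F refl = inj₁ (inj₂ (e * 4 , (inside , CopyAt-scale 2 (CopyAt-single e te≡b)) , +-comm 2 (e * 4)))
    where
    te≡b : tmBit e ≡ true
    te≡b = not-injective (trans (sym (blockLetter 2 e 2)) (copy ! 0))
  ... | result e 3F refl =
    inj₂ (e * 4 , (next-multiple 4∣M (n∣m*n (suc e)) 0 inside , CopyAt-scale 2 (CopyAt-pair e te≡a te+1≡b)) ,
          +-comm 3 (e * 4))
    where
    te≡a : tmBit e ≡ false
    te≡a = trans (sym (blockLetter 2 e 3)) (copy ! 0)
    te+1≡b : tmBit (suc e) ≡ true
    te+1≡b = trans (sym (blockLetter 2 (suc e) 0)) (copy ! 1)

  ab-split⇐ : ∀ c → (abba ∪ baab ⊕ 2 ∪ abbabaab ⊕ 3) c → ab c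
  ab-split⇐ c (inj₁ (inj₁ w)) =
    subst ab (+-identityʳ c) (CopyWithin-compose w ab-at-0 (≤ᵇ⇒≤ 2 4 _))
  ab-split⇐ _ (inj₁ (inj₂ (_ , w , refl))) = CopyWithin-compose w ba-at-2 (≤ᵇ⇒≤ 4 4 _)
  ab-split⇐ _ (inj₂ (_ , w , refl))        = CopyWithin-compose w ab-at-3 (≤ᵇ⇒≤ 5 8 _)

  ab-split : 4 ∣ M → ab ≐ abba ∪ baab ⊕ 2 ∪ abbabaab ⊕ 3
  ab-split 4∣M c = ab-split⇒ 4∣M c , ab-split⇐ c

  baabba : 8 ∣ M → ∀ c → baab c → abba (2 + c) → (T₅ ⊕ 4 ∪ T₅ᶜ ⊕ 6) c
  baabba 8∣M c (_ , baab) (inside , abba) with c divMod 8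
  ... | result g 0F refl = ⊥-elim (letters-clash (sameBlockLetter 3 g 0 5 refl) (baab ! 0) (abba ! 3))
  ... | result g 1F refl = ⊥-elim (letters-clash (sameBlockLetter 3 g 1 2 refl) (baab ! 0) (baab ! 1))
  ... | result g 2F refl = ⊥-elim (letters-clash (sameBlockLetter 3 g 3 5 refl) (baab ! 1) (baab ! 3))
  ... | result g 3F refl = ⊥-elim (letters-clash (sameBlockLetter 3 g 3 5 refl) (baab ! 0) (baab ! 2))
  ... | result g 4F refl =
    inj₁ (g * 8 , (next-multiple 8∣M (n∣m*n (suc g)) 1 inside , CopyAt-scale 3 (CopyAt-pair g tg≡a tg+1≡b)) ,
          +-comm 4 (g * 8))
    where
    tg≡a : tmBit g ≡ false
    tg≡a = not-injective (trans (sym (blockLetter 3 g 4)) (baab ! 0))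
    tg+1≡b : tmBit (suc g) ≡ true
    tg+1≡b = trans (sym (blockLetter 3 (suc g) 0)) (abba ! 2)
  ... | result g 5F refl = ⊥-elim (letters-clash (sameBlockLetter 3 g 5 6 refl) (baab ! 0) (baab ! 1))
  ... | result g 6F refl =
    inj₂ (g * 8 , (next-multiple 8∣M (n∣m*n (suc g)) 3 inside , CopyAt-scale 3 (CopyAt-pair g tg≡b tg+1≡a)) ,
          +-comm 6 (g * 8))
    where
    tg≡b : tmBit g ≡ true
    tg≡b = trans (sym (blockLetter 3 g 6)) (baab ! 0)
    tg+1≡a : tmBit (suc g) ≡ false
    tg+1≡a = trans (sym (blockLetter 3 (suc g) 0)) (baab ! 2)
  ... | result g 7F refl = ⊥-elim (letters-clash (sameBlockLetter 3 (suc g) 0 3 refl) (baab ! 1) (abba ! 2))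

  ⊕-shift : ∀ {Q d c} e → (Q ⊕ d) c → (Q ⊕ (d + e)) (c + e)
  ⊕-shift {d = d} e (c₀ , q , refl) = c₀ , q , +-assoc c₀ d e

  abba-baab-overlap⇒ : 8 ∣ M → ∀ c → (abba ∩ baab ⊕ 2) c → (T₅ ⊕ 6 ∪ T₅ᶜ ⊕ 8) c
  abba-baab-overlap⇒ 8∣M _ (abba-at , c₀ , baab-at , refl) =
    Sum.map (⊕-shift 2) (⊕-shift 2) (baabba 8∣M c₀ baab-at (subst abba (+-comm c₀ 2) abba-at))

  abba-baab-overlap⇐ : ∀ c → (T₅ ⊕ 6 ∪ T₅ᶜ ⊕ 8) c → (abba ∩ baab ⊕ 2) c
  abba-baab-overlap⇐ _ (inj₁ (c₀ , w , refl)) =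
    CopyWithin-compose w abba-at-6 (≤ᵇ⇒≤ 10 16 _) ,
    c₀ + 4 , CopyWithin-compose w baab-at-4 (≤ᵇ⇒≤ 8 16 _) , sym (+-assoc c₀ 4 2)
  abba-baab-overlap⇐ _ (inj₂ (c₀ , w , refl)) =
    CopyWithin-compose w baab-at-8 (≤ᵇ⇒≤ 12 16 _) ,
    c₀ + 6 , CopyWithin-compose w abba-at-6 (≤ᵇ⇒≤ 10 16 _) , sym (+-assoc c₀ 6 2)

  abba-baab-overlap : 8 ∣ M → abba ∩ baab ⊕ 2 ≐ T₅ ⊕ 6 ∪ T₅ᶜ ⊕ 8
  abba-baab-overlap 8∣M c = abba-baab-overlap⇒ 8∣M c , abba-baab-overlap⇐ c

  abba-baab-overlap-short : M < 16 → T₅ ⊕ 6 ∪ T₅ᶜ ⊕ 8 ≐ ∅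
  abba-baab-overlap-short M<16 _ =
    (λ { (inj₁ (_ , w , _)) → CopyWithin-too-long M<16 w ; (inj₂ (_ , w , _)) → CopyWithin-too-long M<16 w }) , λ ()

  abba-abbabaab-disjoint : abba ∩ abbabaab ⊕ 3 ≐ ∅
  abba-abbabaab-disjoint _ = (λ { ((_ , abba-at) , c₀ , (_ , abbabaab-at) , refl) →
    letters-clash refl (abbabaab-at ! 5) (subst (CopyAt false 2) (+-comm c₀ 3) abba-at ! 2) }) , λ ()

  baab-abbabaab-disjoint : baab ⊕ 2 ∩ abbabaab ⊕ 3 ≐ ∅
  baab-abbabaab-disjoint _ = (λ { ((c₀ , (_ , baab-at) , refl) , c₁ , (_ , abbabaab-at) , c₀+2≡c₁+3) →
    letters-clash refl (abbabaab-at ! 2)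
      (subst (CopyAt true 2) (+-cancelʳ-≡ 2 c₀ (suc c₁) (trans c₀+2≡c₁+3 (+-suc c₁ 2))) baab-at ! 1) }) , λ ()

self-occurrences : ∀ (w : Word) → OccursAt w w ≐ ｛ 1 ｝
self-occurrences w p = to , λ { refl → [] , [] , sym (++-identityʳ w) , refl }
  where
  to : OccursAt w w p → p ≡ 1
  to ([]    , _ , _    , refl) = refl
  to (_ ∷ x , y , w≡xwy , refl) = ⊥-elim (m≢1+m+n (length w) (begin
    length w                                ≡⟨ cong length w≡xwy ⟩
    suc (length (x ++ w ++ y))              ≡⟨ cong suc (trans (length-++ x) (cong (length x +_) (length-++ w))) ⟩
    suc (length x + (length w + length y))  ≡⟨ cong suc (x∙yz≈y∙xz (length x) (length w) (length y)) ⟩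
    suc (length w + (length x + length y))  ∎))
    where open ≡-Reasoning

a-in-ab-at-0-only : ∀ {q} → CopyWithin 2 false 0 q → q ≡ 0
a-in-ab-at-0-only {zero}        _                = refl
a-in-ab-at-0-only {suc zero}    (_ , copy)        with letter copy 0 z<s
... | ()
a-in-ab-at-0-only {suc (suc _)} (s≤s (s≤s ()) , _)

ab-in-abba-at-0-only : ∀ {c} → CopyWithin 4 false 1 c → c ≡ 0
ab-in-abba-at-0-only {zero}              _                          = refl
ab-in-abba-at-0-only {suc zero}          (_ , copy)                 with letter copy 0 z<s
... | ()
ab-in-abba-at-0-only {suc (suc zero)}    (_ , copy)                 with letter copy 1 (s≤s (s≤s z≤n))
... | ()
ab-in-abba-at-0-only {suc (suc (suc _))} (s≤s (s≤s (s≤s (s≤s ()))) , _)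

tm-in-successor : ∀ n → OccursAt (tm n) (tm (suc n)) ≐ ｛ 1 ｝
tm-in-successor n p = to n , λ { refl → [] , compl (tm n) , refl , refl }
  where
  to : ∀ n → OccursAt (tm n) (tm (suc n)) p → p ≡ 1
  to zero occ with occursAt-tm⇒ false 0 1 occ
  ... | q , refl , within = cong suc (a-in-ab-at-0-only within)
  to (suc a) occ with proj₁ (occurrences-scaled false a 0 2 (+-comm 1 a) (+-comm 2 a) p) occ
  ... | c , within , refl rewrite ab-in-abba-at-0-only within = refl

index-∸ : ∀ {i} m n → m + suc n ≡ i → i ∸ m ∸ 1 ≡ n
index-∸ m n refl = cong (_∸ 1) (m+n∸m≡n m (suc n))

τ-∸ : ∀ {i} m k a → m + suc (k + a) ≡ i → τ (i ∸ m) ≡ 2 ^ k * 2 ^ a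
τ-∸ m k a e = trans (cong (2 ^_) (index-∸ m (k + a) e)) (^-distribˡ-+-* 2 k a)

module Scale (j′ a : ℕ) where

  i j N : ℕ
  j = 2 + j′
  i = j + 2 + a
  N = 3 + j′

  open Prefix (2 ^ N) public

  -- hypotheses mention the definition of i, which the ring solver cannot unfold
  occurrences : ∀ b m K → m + suc (a + suc K) ≡ 2 + j′ + 2 + a →
                OccursAt (tmFlip b (i ∸ m ∸ 1)) (tm (i ∸ 1)) ≐ scaled a (CopyWithin (2 ^ N) b (suc K))
  occurrences b m K e =
    occurrences-scaled b a K N (index-∸ m _ e) (index-∸ {2 + j′ + 2 + a} 0 (a + (3 + j′)) (solve (j′ ∷ a ∷ [])))

  τ-i : ∀ m k → m + suc (k + a) ≡ 2 + j′ + 2 + a → τ (i ∸ m) ≡ 2 ^ k * 2 ^ a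
  τ-i m k = τ-∸ m k a

  Aⱼ-scaled : A i j ≐ scaled a ab
  Aⱼ-scaled = occurrences false (2 + j′) 0 (solve (j′ ∷ a ∷ []))

  Aⱼ₋₁-scaled : A i (j ∸ 1) ≐ scaled a abba
  Aⱼ₋₁-scaled = occurrences false (1 + j′) 1 (solve (j′ ∷ a ∷ []))

  B′-scaled : B′ i j ≐ scaled a (baab ⊕ 2)
  B′-scaled = ≐-trans (⊕-cong Bⱼ₋₁-scaled (τ-i (2 + j′) 1 (solve (j′ ∷ a ∷ [])))) (≐-sym (scaled-⊕ a 2))
    where
    Bⱼ₋₁-scaled : B i (j ∸ 1) ≐ scaled a baab
    Bⱼ₋₁-scaled = occurrences true (1 + j′) 1 (solve (j′ ∷ a ∷ []))

  A′-scaled : A′ i j ≐ scaled a (abbabaab ⊕ 3)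
  A′-scaled = ≐-trans (⊕-cong Aⱼ₋₂-scaled shift₃) (≐-sym (scaled-⊕ a 3))
    where
    Aⱼ₋₂-scaled : A i (j ∸ 2) ≐ scaled a abbabaab
    Aⱼ₋₂-scaled = occurrences false j′ 2 (solve (j′ ∷ a ∷ []))
    shift₃ : τ (i ∸ j) + τ (i ∸ (j + 1)) ≡ 3 * 2 ^ a
    shift₃ = trans (cong₂ _+_ (τ-i (2 + j′) 1 (solve (j′ ∷ a ∷ []))) (τ-i (2 + j′ + 1) 0 (solve (j′ ∷ a ∷ []))))
                   (sym (*-distribʳ-+ (2 ^ a) 2 1))

  8∣2^N : 8 ∣ 2 ^ N
  8∣2^N = divides (2 ^ j′) (trans (^-distribˡ-+-* 2 3 j′) (*-comm 8 (2 ^ j′)))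

  decomposition : A i j ≐ A i (j ∸ 1) ∪ B′ i j ∪ A′ i j
  decomposition = begin
    A i j                                                          ≈⟨ Aⱼ-scaled ⟩
    scaled a ab                                                    ≈⟨ scaled-cong a (ab-split 4∣2^N) ⟩
    scaled a (abba ∪ baab ⊕ 2 ∪ abbabaab ⊕ 3)                      ≈⟨ scaled-∪ a ⟩
    scaled a (abba ∪ baab ⊕ 2) ∪ scaled a (abbabaab ⊕ 3)           ≈⟨ ∪-cong (scaled-∪ a) ≐-refl ⟩
    scaled a abba ∪ scaled a (baab ⊕ 2) ∪ scaled a (abbabaab ⊕ 3)  ≈⟨ ∪-cong (∪-cong Aⱼ₋₁-scaled B′-scaled) A′-scaled ⟨
    A i (j ∸ 1) ∪ B′ i j ∪ A′ i j                                  ∎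
    where
    open SetoidReasoning ≐-setoid
    4∣2^N : 4 ∣ 2 ^ N
    4∣2^N = ∣-trans (divides 2 refl) 8∣2^N

  Aⱼ₋₁∩B′ : A i (j ∸ 1) ∩ B′ i j ≐ scaled a (T₅ ⊕ 6 ∪ T₅ᶜ ⊕ 8)
  Aⱼ₋₁∩B′ = ≐-trans (∩-cong Aⱼ₋₁-scaled B′-scaled)
              (≐-trans (≐-sym (scaled-∩ a)) (scaled-cong a (abba-baab-overlap 8∣2^N)))

  Aⱼ₋₁∩A′ : A i (j ∸ 1) ∩ A′ i j ≐ ∅
  Aⱼ₋₁∩A′ = ≐-trans (∩-cong Aⱼ₋₁-scaled A′-scaled)
              (≐-trans (≐-sym (scaled-∩ a)) (≐-trans (scaled-cong a abba-abbabaab-disjoint) (scaled-∅ a)))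

  B′∩A′ : B′ i j ∩ A′ i j ≐ ∅
  B′∩A′ = ≐-trans (∩-cong B′-scaled A′-scaled)
            (≐-trans (≐-sym (scaled-∩ a)) (≐-trans (scaled-cong a baab-abbabaab-disjoint) (scaled-∅ a)))

I-scaled : ∀ j′ a → let open Scale j′ a in I i j ≐ scaled a (T₅ ⊕ 6 ∪ T₅ᶜ ⊕ 8)
I-scaled zero a = ≐-sym (≐-trans (scaled-cong a (abba-baab-overlap-short (≤ᵇ⇒≤ 9 16 _))) (scaled-∅ a))
  where open Scale 0 a
I-scaled (suc k) a = begin
  I i j                                                 ≈⟨ ∪-cong (⊕-cong Aₖ shift₆) (⊕-cong Bₖ shift₈) ⟩
  scaled a T₅ ⊕ 6 * 2 ^ a ∪ scaled a T₅ᶜ ⊕ 8 * 2 ^ a    ≈⟨ ∪-cong (scaled-⊕ a 6) (scaled-⊕ a 8) ⟨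
  scaled a (T₅ ⊕ 6) ∪ scaled a (T₅ᶜ ⊕ 8)                ≈⟨ scaled-∪ a ⟨
  scaled a (T₅ ⊕ 6 ∪ T₅ᶜ ⊕ 8)                          ∎
  where
  open Scale (suc k) a
  open SetoidReasoning ≐-setoid
  Aₖ : A i k ≐ scaled a T₅
  Aₖ = occurrences false k 3 (solve (k ∷ a ∷ []))
  Bₖ : B i k ≐ scaled a T₅ᶜ
  Bₖ = occurrences true k 3 (solve (k ∷ a ∷ []))
  shift₆ : τ (i ∸ (k + 2)) + τ (i ∸ (k + 3)) ≡ 6 * 2 ^ a
  shift₆ = trans (cong₂ _+_ (τ-i (k + 2) 2 (solve (k ∷ a ∷ []))) (τ-i (k + 3) 1 (solve (k ∷ a ∷ []))))
                 (sym (*-distribʳ-+ (2 ^ a) 4 2))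
  shift₈ : τ (i ∸ (k + 1)) ≡ 8 * 2 ^ a
  shift₈ = τ-i (k + 1) 3 (solve (k ∷ a ∷ []))

theorem18 : ((i : ℕ) → 2 ≤ i → (A i 0 ≐ ｛ 1 ｝) × (A i 1 ≐ ｛ 1 ｝))
    × ((i j : ℕ) → 2 ≤ j → j + 2 ≤ i →
        (A i j ≐ A i (j ∸ 1) ∪ B′ i j ∪ A′ i j)
        × (A i (j ∸ 1) ∩ B′ i j ≐ I i j)
        × (A i (j ∸ 1) ∩ A′ i j ≐ ∅)
        × (B′ i j ∩ A′ i j ≐ ∅))
theorem18 = initial , recurrence
  where
  initial : (i : ℕ) → 2 ≤ i → (A i 0 ≐ ｛ 1 ｝) × (A i 1 ≐ ｛ 1 ｝)
  initial (suc zero)    (s≤s ())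
  initial (suc (suc n)) _ = self-occurrences (tm (suc n)) , tm-in-successor n
  recurrence : (i j : ℕ) → 2 ≤ j → j + 2 ≤ i →
               (A i j ≐ A i (j ∸ 1) ∪ B′ i j ∪ A′ i j) × (A i (j ∸ 1) ∩ B′ i j ≐ I i j)
               × (A i (j ∸ 1) ∩ A′ i j ≐ ∅) × (B′ i j ∩ A′ i j ≐ ∅)
  recurrence i (suc zero)     (s≤s ()) _
  recurrence i (suc (suc j′)) _ j+2≤i with m≤n⇒∃[o]m+o≡n j+2≤i
  ... | a , refl = decomposition , ≐-trans Aⱼ₋₁∩B′ (≐-sym (I-scaled j′ a)) , Aⱼ₋₁∩A′ , B′∩A′
    where open Scale j′ a
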